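{- For each integer $n \ge 5$, let $D(n)$ be the maximum of $|E(G)|/\binom{n}{2}$ over all distance critical graphs $G$ on $n$ vertices. Then $1 - O(1/\sqrt{n}) \le D(n) \le 1 - \Omega(1/n)$ as $n \to \infty$.
   Context: All graphs are finite, simple and undirected. For vertices $x,y$ of a graph $G$, $d_G(x,y)$ is the length of a shortest path from $x$ to $y$ in $G$ ($\infty$ if none exists). A graph $G$ is distance critical if for every vertex $v \in V(G)$ there exist vertices $x,y \in V(G)\setminus\{v\}$ with $d_G(x,y) \neq d_{G-v}(x,y)$. The edge density of a graph on $n$ vertices is $|E(G)|/\binom{n}{2}$. -}

module Defs where

open import Data.Nat using (ℕ; zero; suc; _+_; _<_; _<ᵇ_)
open import Data.Bool using (Bool; true; false; _∧_; if_then_else_)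
open import Data.Fin using (Fin; toℕ; punchIn)
open import Data.Maybe using (Maybe; just; nothing)
open import Data.Product using (Σ; _×_)
open import Data.Unit using (⊤)
open import Relation.Nullary using (¬_)
open import Relation.Binary.PropositionalEquality using (_≡_)

record Graph (n : ℕ) : Set where
  field
    adj    : Fin n → Fin n → Bool
    sym    : ∀ i j → adj i j ≡ adj j i
    irrefl : ∀ i → adj i i ≡ false
open Graph public

_─_ : {m : ℕ} → Graph (suc m) → Fin (suc m) → Graph m
adj (G ─ v) i j = adj G (punchIn v i) (punchIn v j)
sym (G ─ v) i j = sym G (punchIn v i) (punchIn v j)
irrefl (G ─ v) i = irrefl G (punchIn v i)

data Walk {n : ℕ} (G : Graph n) : ℕ → Fin n → Fin n → Set where
  here : ∀ {x} → Walk G 0 x x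
  step : ∀ {k x z y} → adj G x z ≡ true → Walk G k z y → Walk G (suc k) x y

-- IsDist G x y d : d_G(x,y) = d, where nothing stands for ∞.
-- (The length of a shortest path equals the length of a shortest walk.)
IsDist : {n : ℕ} → Graph n → Fin n → Fin n → Maybe ℕ → Set
IsDist G x y (just k) = Walk G k x y × (∀ j → j < k → ¬ Walk G j x y)
IsDist G x y nothing  = ∀ k → ¬ Walk G k x y

-- Distance critical: every vertex v has x,y ≠ v with d_G(x,y) ≠ d_{G-v}(x,y).
-- Vertices x,y of G - v correspond to punchIn v x, punchIn v y in G.
DistanceCritical : {n : ℕ} → Graph n → Set
DistanceCritical {zero}  G = ⊤
DistanceCritical {suc m} G =
  ∀ (v : Fin (suc m)) → Σ (Fin m) λ x → Σ (Fin m) λ y → Σ (Maybe ℕ) λ d →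
    IsDist G (punchIn v x) (punchIn v y) d × ¬ IsDist (G ─ v) x y d

sumFin : {n : ℕ} → (Fin n → ℕ) → ℕ
sumFin {zero}  f = 0
sumFin {suc n} f = f Fin.zero + sumFin (λ i → f (Fin.suc i))

edges : {n : ℕ} → Graph n → ℕ
edges G = sumFin λ i → sumFin λ j →
  if (toℕ i <ᵇ toℕ j) ∧ adj G i j then 1 else 0

{-# OPTIONS --safe #-}
module Submission where

-- Let v be a vertex and x, y vertices whose distance k changes when v is
-- deleted.  Every x–y walk avoiding v is then longer than k, so x ≠ y are nonadjacent and
-- v is their only possible common neighbour.  Hence each of the other n − 3 vertices is a
-- non-neighbour of x or of y, there are at least (n − 1)/2 non-edges, and
-- C(n,2) ≤ n · (C(n,2) − |E(G)|).
--
-- Take a clique on m vertices and two copies of R disjoint 5-cycles, and join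
-- clique vertex t to one vertex in each copy, the pair of attachment vertices being
-- injective in t (possible when m ≤ (5R)²).  Each vertex is then the unique common
-- neighbour of two nonadjacent vertices: a clique vertex of its two attachment vertices, a
-- cycle vertex of its two cycle neighbours.  Deleting it increases their distance from 2.
-- With R = ⌊√n⌋ and m = n − 10R, every non-edge meets one of the 10R cycle vertices, so
-- C(n,2) − |E(G)| ≤ 10R · n = O(C(n,2)/√n).

open import Defs renaming (sym to adj-sym)
open import Data.Nat using (ℕ; zero; suc; _+_; _*_; _∸_; _^_; _≤_; _<_; _<ᵇ_; z≤n; s≤s; _<?_)
open import Data.Nat.Properties hiding (_≟_)
open import Data.Nat.Combinatorics using (_C_; nCk+nC[k+1]≡[n+1]C[k+1]; nC1≡n)
open import Data.Nat.Tactic.RingSolver using (solve)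
open import Algebra.Properties.CommutativeMonoid.Sum +-0-commutativeMonoid
  using (sum; sum-syntax; sum-cong-≗; ∑-distrib-+; ∑-comm; sum-remove)
open import Data.Bool as Bool using (Bool; true; false; _∧_; _∨_; not; if_then_else_; T)
open import Data.Bool.Properties using (∨-comm; ∧-conicalʳ; ¬-not)
open import Data.Fin as Fin using (Fin; toℕ; punchIn; punchOut; _↑ˡ_)
open import Data.Fin.Patterns using (0F; 1F; 2F; 3F; 4F)
open import Data.Fin.Properties
  using (_≟_; all?; punchIn-punchOut; punchInᵢ≢i; punchIn-injective; toℕ-injective;
         toℕ-↑ˡ; splitAt-↑ˡ; inject≤-injective; +↔⊎; *↔×)
open import Data.List using ([]; _∷_)
open import Data.Maybe using (Maybe; just; nothing)
open import Data.Product using (Σ; ∃₂; _×_; _,_; proj₁; proj₂)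
open import Data.Product.Properties using (≡-dec; ×-≡,≡→≡)
open import Data.Product.Function.NonDependent.Propositional using (_×-↔_)
open import Data.Sum using (_⊎_; inj₁; inj₂)
open import Data.Sum.Properties using (inj₂-injective)
open import Data.Sum.Function.Propositional using (_⊎-↔_)
open import Data.Empty using (⊥; ⊥-elim)
open import Data.Unit using (tt)
open import Function using (_∘_; _↔_; _↣_; Inverse; Injection; mk↣; Injective)
open import Function.Properties.Inverse using (↔-refl; ↔⇒↣)
open import Function.Construct.Composition using (_↔-∘_; _↣-∘_)
open import Relation.Nullary
  using (¬_; Dec; yes; no; does; contradiction; ¬?; _×-dec_; _→-dec_; map′)
open import Relation.Nullary.Decidable using (dec-true; dec-false; toWitness)
open import Relation.Binary using (DecidableEquality)
open import Relation.Binary.PropositionalEquality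
  using (_≡_; _≢_; refl; sym; trans; cong; cong₂; subst; subst₂; module ≡-Reasoning)

𝟙 : Bool → ℕ
𝟙 b = if b then 1 else 0

dec-true⁻¹ : ∀ {A : Set} (a? : Dec A) → does a? ≡ true → A
dec-true⁻¹ (yes a) _ = a
dec-true⁻¹ (no _) ()

does-≟-sym : ∀ {A : Set} (_≟ᴬ_ : DecidableEquality A) x y → does (x ≟ᴬ y) ≡ does (y ≟ᴬ x)
does-≟-sym _≟ᴬ_ x y with x ≟ᴬ y
... | yes refl = sym (dec-true (x ≟ᴬ x) refl)
... | no x≢y   = sym (dec-false (y ≟ᴬ x) (x≢y ∘ sym))

sumFin≡sum : ∀ {n} (f : Fin n → ℕ) → sumFin f ≡ sum f
sumFin≡sum {zero}  f = refl
sumFin≡sum {suc n} f = cong (f Fin.zero +_) (sumFin≡sum (f ∘ Fin.suc))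

sum-mono-≤ : ∀ {n} {f g : Fin n → ℕ} → (∀ i → f i ≤ g i) → sum f ≤ sum g
sum-mono-≤ {zero}  f≤g = z≤n
sum-mono-≤ {suc n} f≤g = +-mono-≤ (f≤g Fin.zero) (sum-mono-≤ (f≤g ∘ Fin.suc))

sum-ones : ∀ n → sum {n} (λ _ → 1) ≡ n
sum-ones zero    = refl
sum-ones (suc n) = cong suc (sum-ones n)

term≤sum : ∀ {n} (f : Fin n → ℕ) i → f i ≤ sum f
term≤sum {suc n} f i = ≤-trans (m≤m+n (f i) _) (≤-reflexive (sym (sum-remove {i = i} f)))

pair≤sum : ∀ {n} (f : Fin n → ℕ) {p q} → p ≢ q → f p + f q ≤ sum f
pair≤sum {suc n} f {p} {q} p≢q = begin
  f p + f q                           ≡⟨ cong (λ i → f p + f i) (punchIn-punchOut p≢q) ⟨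
  f p + f (punchIn p (punchOut p≢q))  ≤⟨ +-monoʳ-≤ (f p) (term≤sum (f ∘ punchIn p) (punchOut p≢q)) ⟩
  f p + sum (f ∘ punchIn p)           ≡⟨ sum-remove {i = p} f ⟨
  sum f                               ∎
  where open ≤-Reasoning

punctured-count≤sum : ∀ {m} (f : Fin (suc m) → ℕ) v → (∀ j → j ≢ v → 1 ≤ f j) → m ≤ sum f
punctured-count≤sum {m} f v f≥1 = begin
  m                          ≡⟨ sum-ones m ⟨
  sum {m} (λ _ → 1)          ≤⟨ sum-mono-≤ (λ j → f≥1 (punchIn v j) (punchInᵢ≢i v j)) ⟩
  sum (f ∘ punchIn v)        ≤⟨ m≤n+m _ (f v) ⟩
  f v + sum (f ∘ punchIn v)  ≡⟨ sum-remove {i = v} f ⟨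
  sum f                      ∎
  where open ≤-Reasoning

sum-↑ˡ≤sum : ∀ {m k} (f : Fin (m + k) → ℕ) → sum (λ i → f (i ↑ˡ k)) ≤ sum f
sum-↑ˡ≤sum {zero}      f = z≤n
sum-↑ˡ≤sum {suc m} {k} f = +-monoʳ-≤ (f Fin.zero) (sum-↑ˡ≤sum {m} {k} (f ∘ Fin.suc))

∑∑-distrib-+ : ∀ {n} (f g : Fin n → Fin n → ℕ) →
  ∑[ i < n ] ∑[ j < n ] (f i j + g i j) ≡
  ∑[ i < n ] ∑[ j < n ] f i j + ∑[ i < n ] ∑[ j < n ] g i j
∑∑-distrib-+ {n} f g = trans (sum-cong-≗ λ i → ∑-distrib-+ (f i) (g i))
  (∑-distrib-+ {n} (λ i → ∑[ j < n ] f i j) (λ i → ∑[ j < n ] g i j))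

[1+n]C2≡n+nC2 : ∀ n → suc n C 2 ≡ n + n C 2
[1+n]C2≡n+nC2 n = trans (sym (nCk+nC[k+1]≡[n+1]C[k+1] n 1)) (cong (_+ n C 2) (nC1≡n n))

2*[1+m]C2≡[1+m]*m : ∀ m → 2 * (suc m C 2) ≡ suc m * m
2*[1+m]C2≡[1+m]*m zero    = refl
2*[1+m]C2≡[1+m]*m (suc m) = begin
  2 * (suc (suc m) C 2)        ≡⟨ cong (2 *_) ([1+n]C2≡n+nC2 (suc m)) ⟩
  2 * (suc m + suc m C 2)      ≡⟨ *-distribˡ-+ 2 (suc m) (suc m C 2) ⟩
  2 * suc m + 2 * (suc m C 2)  ≡⟨ cong (2 * suc m +_) (2*[1+m]C2≡[1+m]*m m) ⟩
  2 * suc m + suc m * m        ≡⟨ solve (m ∷ []) ⟩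
  suc (suc m) * suc m          ∎
  where open ≡-Reasoning

[m+j]C2≤mC2+j*[m+j] : ∀ m j → (m + j) C 2 ≤ m C 2 + j * (m + j)
[m+j]C2≤mC2+j*[m+j] m zero    rewrite +-identityʳ m = m≤m+n _ _
[m+j]C2≤mC2+j*[m+j] m (suc j) rewrite +-suc m j = begin
  suc (m + j) C 2                          ≡⟨ [1+n]C2≡n+nC2 (m + j) ⟩
  (m + j) + (m + j) C 2                    ≤⟨ +-monoʳ-≤ (m + j) ([m+j]C2≤mC2+j*[m+j] m j) ⟩
  (m + j) + (m C 2 + j * (m + j))          ≤⟨ m≤m+n _ (suc j) ⟩
  (m + j) + (m C 2 + j * (m + j)) + suc j  ≡⟨ regroup (m C 2) ⟩
  m C 2 + suc j * suc (m + j)              ∎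
  where
  open ≤-Reasoning
  regroup : ∀ c → (m + j) + (c + j * (m + j)) + suc j ≡ c + suc j * suc (m + j)
  regroup c = solve (m ∷ j ∷ c ∷ [])

n*n≤4*nC2 : ∀ n → 2 ≤ n → n * n ≤ 4 * (n C 2)
n*n≤4*nC2 (suc m) (s≤s 1≤m) = begin
  suc m * suc m          ≤⟨ *-monoʳ-≤ (suc m) (+-monoˡ-≤ m 1≤m) ⟩
  suc m * (m + m)        ≡⟨ solve (m ∷ []) ⟩
  2 * (suc m * m)        ≡⟨ cong (2 *_) (2*[1+m]C2≡[1+m]*m m) ⟨
  2 * (2 * (suc m C 2))  ≡⟨ *-assoc 2 2 (suc m C 2) ⟨
  4 * (suc m C 2)        ∎
  where open ≤-Reasoning

[1+m]C2≤[1+m]*M : ∀ m M → m ≤ M + M → suc m C 2 ≤ suc m * M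
[1+m]C2≤[1+m]*M m M m≤2M = *-cancelˡ-≤ 2 (begin
  2 * (suc m C 2)  ≡⟨ 2*[1+m]C2≡[1+m]*m m ⟩
  suc m * m        ≤⟨ *-monoʳ-≤ (suc m) m≤2M ⟩
  suc m * (M + M)  ≡⟨ solve (m ∷ M ∷ []) ⟩
  2 * (suc m * M)  ∎)
  where open ≤-Reasoning

∑∑[i<j]≡nC2 : ∀ n → ∑[ i < n ] ∑[ j < n ] 𝟙 (toℕ i <ᵇ toℕ j) ≡ n C 2
∑∑[i<j]≡nC2 zero    = refl
∑∑[i<j]≡nC2 (suc n) = trans (cong₂ _+_ (sum-ones n) (∑∑[i<j]≡nC2 n)) (sym ([1+n]C2≡n+nC2 n))

module _ {n} {G : Graph n} where

  walk₀ : ∀ {x y} → Walk G 0 x y → x ≡ y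
  walk₀ here = refl

  walk-length≥2 : ∀ {k x y} → x ≢ y → adj G x y ≡ false → Walk G k x y → 2 ≤ k
  walk-length≥2 x≢y _  here                = contradiction refl x≢y
  walk-length≥2 _   xy (step e here)       = contradiction (trans (sym e) xy) λ ()
  walk-length≥2 _   _  (step _ (step _ _)) = s≤s (s≤s z≤n)

adjacent⇒≢ : ∀ {n} (G : Graph n) {x y} → adj G x y ≡ true → x ≢ y
adjacent⇒≢ G {x} e refl = contradiction (trans (sym e) (irrefl G x)) λ ()

lift : ∀ {m} {G : Graph (suc m)} {v k x y} →
  Walk (G ─ v) k x y → Walk G k (punchIn v x) (punchIn v y)
lift here       = here
lift (step e w) = step e (lift w)

Critical : ∀ {m} → Graph (suc m) → Fin (suc m) → Set
Critical {m} G v = Σ (Fin m) λ x → Σ (Fin m) λ y → Σ (Maybe ℕ) λ d →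
  IsDist G (punchIn v x) (punchIn v y) d × ¬ IsDist (G ─ v) x y d

record UniqueMidpoint {V : Set} (E : V → V → Bool) (p q v : V) : Set where
  field
    distinct    : p ≢ q
    nonadjacent : E p q ≡ false
    adjacentˡ   : E p v ≡ true
    adjacentʳ   : E v q ≡ true
    unique      : ∀ u → E p u ≡ true → E u q ≡ true → u ≡ v

AllMidpoints : ∀ {V : Set} → (V → V → Bool) → Set
AllMidpoints {V} E = ∀ v → ∃₂ λ (p q : V) → UniqueMidpoint E p q v

uniqueMidpoint⇒critical : ∀ {m} (G : Graph (suc m)) {p q v} →
  UniqueMidpoint (adj G) p q v → Critical G v
uniqueMidpoint⇒critical G {p} {q} {v} mid =
  punchOut v≢p , punchOut v≢q , just 2 ,
  subst₂ (λ a b → IsDist G a b (just 2)) (sym p-in) (sym q-in) distance2 , avoidingV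
  where
  open UniqueMidpoint mid
  v≢p : v ≢ p
  v≢p = adjacent⇒≢ G adjacentˡ ∘ sym
  v≢q : v ≢ q
  v≢q = adjacent⇒≢ G adjacentʳ
  p-in : punchIn v (punchOut v≢p) ≡ p
  p-in = punchIn-punchOut v≢p
  q-in : punchIn v (punchOut v≢q) ≡ q
  q-in = punchIn-punchOut v≢q
  distance2 : IsDist G p q (just 2)
  distance2 = step adjacentˡ (step adjacentʳ here) , λ j j<2 w →
    <⇒≱ j<2 (walk-length≥2 distinct nonadjacent w)
  avoidingV : ¬ IsDist (G ─ v) (punchOut v≢p) (punchOut v≢q) (just 2)
  avoidingV (step {z = z} e₁ (step e₂ here) , _) = punchInᵢ≢i v z (unique (punchIn v z)
    (subst (λ a → adj G a _ ≡ true) p-in e₁) (subst (λ b → adj G _ b ≡ true) q-in e₂))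

midpoints⇒distanceCritical : ∀ {n} (G : Graph n) → AllMidpoints (adj G) → DistanceCritical G
midpoints⇒distanceCritical {zero}  G _      = tt
midpoints⇒distanceCritical {suc n} G mids v = uniqueMidpoint⇒critical G (proj₂ (proj₂ (mids v)))

record FarApartWithout {V : Set} (E : V → V → Bool) (v : V) : Set where
  field
    p q               : V
    distinct          : p ≢ q
    nonadjacent       : E p q ≡ false
    noCommonNeighbour : ∀ u → u ≢ v → E p u ≡ true → E u q ≡ true → ⊥

critical⇒farApart : ∀ {m} (G : Graph (suc m)) {v} → Critical G v → FarApartWithout (adj G) v
critical⇒farApart G {v} (x , y , nothing , unreachable , ¬unreachable) =
  ⊥-elim (¬unreachable λ k w → unreachable k (lift w))
critical⇒farApart G {v} (x , y , just k , (walk , minimal) , ¬dist) = record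
  { p = p ; q = q ; distinct = distinct ; nonadjacent = nonadjacent
  ; noCommonNeighbour = noCommonNeighbour
  }
  where
  p = punchIn v x
  q = punchIn v y
  longer : ∀ {j} → Walk (G ─ v) j x y → k < j
  longer {j} w = ≤∧≢⇒< (≮⇒≥ λ j<k → minimal j j<k (lift w)) λ k≡j →
    ¬dist (subst (λ i → Walk (G ─ v) i x y) (sym k≡j) w , λ i i<k w′ → minimal i i<k (lift w′))
  distinct : p ≢ q
  distinct p≡q = n≮0 (longer (subst (Walk (G ─ v) 0 x) (punchIn-injective v x y p≡q) here))
  nonadjacent : adj G p q ≡ false
  nonadjacent = ¬-not λ e →
    distinct (walk₀ (subst (λ j → Walk G j p q) (n<1⇒n≡0 (longer (step e here))) walk))
  noCommonNeighbour : ∀ u → u ≢ v → adj G p u ≡ true → adj G u q ≡ true → ⊥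
  noCommonNeighbour u u≢v e₁ e₂ = <⇒≱ (longer viaU) (walk-length≥2 distinct nonadjacent walk)
    where
    u-in : punchIn v (punchOut (u≢v ∘ sym)) ≡ u
    u-in = punchIn-punchOut (u≢v ∘ sym)
    viaU : Walk (G ─ v) 2 x y
    viaU = step (subst (λ b → adj G p b ≡ true) (sym u-in) e₁)
                (step (subst (λ a → adj G a q ≡ true) (sym u-in) e₂) here)

module _ {n} (G : Graph n) where

  edge nonEdge nonAdjacent : Fin n → Fin n → ℕ
  edge        i j = 𝟙 ((toℕ i <ᵇ toℕ j) ∧ adj G i j)
  nonEdge     i j = 𝟙 ((toℕ i <ᵇ toℕ j) ∧ not (adj G i j))
  nonAdjacent i j = nonEdge i j + nonEdge j i

  nonEdges : ℕ
  nonEdges = ∑[ i < n ] ∑[ j < n ] nonEdge i j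

  edges≡∑∑edge : edges G ≡ ∑[ i < n ] ∑[ j < n ] edge i j
  edges≡∑∑edge = trans (sumFin≡sum {n} _) (sum-cong-≗ λ i → sumFin≡sum (edge i))

  edges+nonEdges≡nC2 : edges G + nonEdges ≡ n C 2
  edges+nonEdges≡nC2 = begin
    edges G + nonEdges                              ≡⟨ cong (_+ nonEdges) edges≡∑∑edge ⟩
    ∑[ i < n ] ∑[ j < n ] edge i j + nonEdges       ≡⟨ ∑∑-distrib-+ edge nonEdge ⟨
    ∑[ i < n ] ∑[ j < n ] (edge i j + nonEdge i j)  ≡⟨ sum-cong-≗ (λ i → sum-cong-≗ λ j →
                                                         split (toℕ i <ᵇ toℕ j) (adj G i j)) ⟩
    ∑[ i < n ] ∑[ j < n ] 𝟙 (toℕ i <ᵇ toℕ j)       ≡⟨ ∑∑[i<j]≡nC2 n ⟩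
    n C 2                                           ∎
    where
    open ≡-Reasoning
    split : ∀ a b → 𝟙 (a ∧ b) + 𝟙 (a ∧ not b) ≡ 𝟙 a
    split false _     = refl
    split true  true  = refl
    split true  false = refl

  nC2∸edges≡nonEdges : n C 2 ∸ edges G ≡ nonEdges
  nC2∸edges≡nonEdges =
    trans (cong (_∸ edges G) (sym edges+nonEdges≡nC2)) (m+n∸m≡n (edges G) nonEdges)

  ∑∑nonAdjacent≡nonEdges+nonEdges : ∑[ i < n ] ∑[ j < n ] nonAdjacent i j ≡ nonEdges + nonEdges
  ∑∑nonAdjacent≡nonEdges+nonEdges = trans (∑∑-distrib-+ nonEdge (λ i j → nonEdge j i))
    (cong (nonEdges +_) (sym (∑-comm nonEdge)))

  nonadjacent⇒1≤nonAdjacent : ∀ {i j} → i ≢ j → adj G i j ≡ false → 1 ≤ nonAdjacent i j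
  nonadjacent⇒1≤nonAdjacent {i} {j} i≢j ij rewrite adj-sym G j i | ij
    with toℕ i <ᵇ toℕ j in i<j | toℕ j <ᵇ toℕ i in j<i
  ... | true  | _     = s≤s z≤n
  ... | false | true  = s≤s z≤n
  ... | false | false = contradiction (toℕ-injective (≤-antisym (≮⇒≥ (≮ j<i)) (≮⇒≥ (≮ i<j)))) i≢j
    where
    ≮ : ∀ {a b} → (a <ᵇ b) ≡ false → ¬ a < b
    ≮ a≮b a<b = subst T a≮b (<⇒<ᵇ a<b)

farApart⇒m≤nonEdges+nonEdges : ∀ {m} (G : Graph (suc m)) {v} →
  FarApartWithout (adj G) v → m ≤ nonEdges G + nonEdges G
farApart⇒m≤nonEdges+nonEdges {m} G {v} far = begin
  m                                              ≤⟨ punctured-count≤sum _ v covered ⟩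
  ∑[ j < suc m ] (nonAdjacent G p j + nonAdjacent G q j)
                                                 ≡⟨ ∑-distrib-+ (nonAdjacent G p) (nonAdjacent G q) ⟩
  sum (nonAdjacent G p) + sum (nonAdjacent G q)  ≤⟨ pair≤sum (sum ∘ nonAdjacent G) distinct ⟩
  ∑[ i < suc m ] ∑[ j < suc m ] nonAdjacent G i j
                                                 ≡⟨ ∑∑nonAdjacent≡nonEdges+nonEdges G ⟩
  nonEdges G + nonEdges G                        ∎
  where
  open ≤-Reasoning
  open FarApartWithout far
  viaP : ∀ {j} → p ≢ j → adj G p j ≡ false → 1 ≤ nonAdjacent G p j + nonAdjacent G q j
  viaP p≢j pj = ≤-trans (nonadjacent⇒1≤nonAdjacent G p≢j pj) (m≤m+n _ _)
  viaQ : ∀ {j} → q ≢ j → adj G j q ≡ false → 1 ≤ nonAdjacent G p j + nonAdjacent G q j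
  viaQ {j} q≢j jq = ≤-trans (nonadjacent⇒1≤nonAdjacent G q≢j (trans (adj-sym G q j) jq))
                            (m≤n+m _ (nonAdjacent G p j))
  covered : ∀ j → j ≢ v → 1 ≤ nonAdjacent G p j + nonAdjacent G q j
  covered j j≢v with j ≟ p | j ≟ q
  ... | yes refl | _        = viaQ (distinct ∘ sym) nonadjacent
  ... | no _     | yes refl = viaP distinct nonadjacent
  ... | no j≢p   | no j≢q   with adj G p j Bool.≟ true | adj G j q Bool.≟ true
  ...   | no pj  | _      = viaP (j≢p ∘ sym) (¬-not pj)
  ...   | yes _  | no jq  = viaQ (j≢q ∘ sym) (¬-not jq)
  ...   | yes pj | yes jq = ⊥-elim (noCommonNeighbour j j≢v pj jq)

distanceCritical⇒nC2≤n*[nC2∸edges] : ∀ {n} (G : Graph n) → DistanceCritical G →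
  n C 2 ≤ n * (n C 2 ∸ edges G)
distanceCritical⇒nC2≤n*[nC2∸edges] {zero}  G _  = z≤n
distanceCritical⇒nC2≤n*[nC2∸edges] {suc m} G dc rewrite nC2∸edges≡nonEdges G =
  [1+m]C2≤[1+m]*M m (nonEdges G)
    (farApart⇒m≤nonEdges+nonEdges G (critical⇒farApart G {Fin.zero} (dc Fin.zero)))

record SimpleGraph (V : Set) : Set where
  field
    _~_      : V → V → Bool
    ~-sym    : ∀ a b → a ~ b ≡ b ~ a
    ~-irrefl : ∀ a → a ~ a ≡ false
open SimpleGraph

onFin : ∀ {n} {V : Set} → Fin n ↔ V → SimpleGraph V → Graph n
adj     (onFin ι H) i j = _~_ H (Inverse.to ι i) (Inverse.to ι j)
adj-sym (onFin ι H) i j = ~-sym H (Inverse.to ι i) (Inverse.to ι j)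
irrefl  (onFin ι H) i   = ~-irrefl H (Inverse.to ι i)

pullback-midpoint : ∀ {U V : Set} {E : V → V → Bool} (f : U → V) → Injective _≡_ _≡_ f →
  ∀ {p q v} → UniqueMidpoint E (f p) (f q) (f v) → UniqueMidpoint (λ a b → E (f a) (f b)) p q v
pullback-midpoint f f-injective mid = record
  { distinct    = distinct ∘ cong f
  ; nonadjacent = nonadjacent
  ; adjacentˡ   = adjacentˡ
  ; adjacentʳ   = adjacentʳ
  ; unique      = λ u e₁ e₂ → f-injective (unique (f u) e₁ e₂)
  }
  where open UniqueMidpoint mid

onFin-distanceCritical : ∀ {n} {V : Set} (ι : Fin n ↔ V) (H : SimpleGraph V) →
  AllMidpoints (_~_ H) → DistanceCritical (onFin ι H)
onFin-distanceCritical ι H mids = midpoints⇒distanceCritical (onFin ι H) λ v →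
  let (p , q , mid) = mids (to v) in
  from p , from q , pullback-midpoint to (Injection.injective (↔⇒↣ ι))
    (subst₂ (λ a b → UniqueMidpoint (_~_ H) a b (to v))
            (sym (strictlyInverseˡ p)) (sym (strictlyInverseˡ q)) mid)
  where open Inverse ι

copies : ∀ {I C : Set} → DecidableEquality I → SimpleGraph C → SimpleGraph (I × C)
_~_      (copies _≟ᴵ_ H) (i , a) (j , b) = does (i ≟ᴵ j) ∧ _~_ H a b
~-sym    (copies _≟ᴵ_ H) (i , a) (j , b) = cong₂ _∧_ (does-≟-sym _≟ᴵ_ i j) (~-sym H a b)
~-irrefl (copies _≟ᴵ_ H) (i , a)         =
  trans (cong (_∧ _~_ H a a) (dec-true (i ≟ᴵ i) refl)) (~-irrefl H a)

copies-midpoint : ∀ {I C : Set} (_≟ᴵ_ : DecidableEquality I) (H : SimpleGraph C) (i : I) {p q c} →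
  UniqueMidpoint (_~_ H) p q c → UniqueMidpoint (_~_ (copies _≟ᴵ_ H)) (i , p) (i , q) (i , c)
copies-midpoint _≟ᴵ_ H i {p} {q} {c} mid = record
  { distinct    = distinct ∘ cong proj₂
  ; nonadjacent = within-copy nonadjacent
  ; adjacentˡ   = within-copy adjacentˡ
  ; adjacentʳ   = within-copy adjacentʳ
  ; unique      = unique′
  }
  where
  open UniqueMidpoint mid
  within-copy : ∀ {a b β} → _~_ H a b ≡ β → does (i ≟ᴵ i) ∧ _~_ H a b ≡ β
  within-copy e rewrite dec-true (i ≟ᴵ i) refl = e
  unique′ : ∀ u → _~_ (copies _≟ᴵ_ H) (i , p) u ≡ true → _~_ (copies _≟ᴵ_ H) u (i , q) ≡ true →
    u ≡ (i , c)
  unique′ (j , u) e₁ e₂ with i ≟ᴵ j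
  ... | yes refl = cong (i ,_) (unique u e₁ (∧-conicalʳ _ _ e₂))
  ... | no _     = contradiction e₁ λ ()

uniqueMidpoint? : ∀ {n} (E : Fin n → Fin n → Bool) p q v → Dec (UniqueMidpoint E p q v)
uniqueMidpoint? E p q v = map′
  (λ (d , n , l , r , u) →
     record { distinct = d ; nonadjacent = n ; adjacentˡ = l ; adjacentʳ = r ; unique = u })
  (λ mid → let open UniqueMidpoint mid in distinct , nonadjacent , adjacentˡ , adjacentʳ , unique)
  (¬? (p ≟ q) ×-dec (E p q Bool.≟ false) ×-dec (E p v Bool.≟ true) ×-dec (E v q Bool.≟ true) ×-dec
   all? λ u → (E p u Bool.≟ true) →-dec (E u q Bool.≟ true) →-dec (u ≟ v))

next : Fin 5 → Fin 5
next 0F = 1F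
next 1F = 2F
next 2F = 3F
next 3F = 4F
next 4F = 0F

prev : Fin 5 → Fin 5
prev = next ∘ next ∘ next ∘ next

cycle5 : SimpleGraph (Fin 5)
_~_      cycle5 x y = does (next x ≟ y) ∨ does (next y ≟ x)
~-sym    cycle5 x y = ∨-comm (does (next x ≟ y)) (does (next y ≟ x))
~-irrefl cycle5 0F  = refl
~-irrefl cycle5 1F  = refl
~-irrefl cycle5 2F  = refl
~-irrefl cycle5 3F  = refl
~-irrefl cycle5 4F  = refl

cycle5-midpoint : ∀ x → UniqueMidpoint (_~_ cycle5) (prev x) (next x) x
cycle5-midpoint = toWitness {a? = all? λ x → uniqueMidpoint? (_~_ cycle5) (prev x) (next x) x} tt

cycles : ∀ R → SimpleGraph (Fin R × Fin 5)
cycles R = copies _≟_ cycle5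

cycles-midpoints : ∀ R → AllMidpoints (_~_ (cycles R))
cycles-midpoints R (i , x) =
  (i , prev x) , (i , next x) , copies-midpoint _≟_ cycle5 i (cycle5-midpoint x)

endpoint : ∀ {C : Set} → C × C → Fin 2 → C
endpoint (a , _) 0F = a
endpoint (_ , b) 1F = b

module CliqueJoin {C : Set} (_≟ᶜ_ : DecidableEquality C) (H : SimpleGraph C) {m}
                  (ℓ : Fin m ↣ (C × C)) where

  open Injection ℓ using (to; injective)

  gadget : SimpleGraph (Fin 2 × C)
  gadget = copies _≟_ H

  join : SimpleGraph (Fin m ⊎ (Fin 2 × C))
  _~_ join (inj₁ t)       (inj₁ t′)      = not (does (t ≟ t′))
  _~_ join (inj₁ t)       (inj₂ (s , c)) = does (endpoint (to t) s ≟ᶜ c)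
  _~_ join (inj₂ (s , c)) (inj₁ t)       = does (endpoint (to t) s ≟ᶜ c)
  _~_ join (inj₂ w)       (inj₂ w′)      = _~_ gadget w w′
  ~-sym join (inj₁ t) (inj₁ t′) = cong not (does-≟-sym _≟_ t t′)
  ~-sym join (inj₁ _) (inj₂ _)  = refl
  ~-sym join (inj₂ _) (inj₁ _)  = refl
  ~-sym join (inj₂ w) (inj₂ w′) = ~-sym gadget w w′
  ~-irrefl join (inj₁ t) = cong not (dec-true (t ≟ t) refl)
  ~-irrefl join (inj₂ w) = ~-irrefl gadget w

  gadget-midpoint : ∀ {s p q c} → UniqueMidpoint (_~_ gadget) (s , p) (s , q) (s , c) →
    UniqueMidpoint (_~_ join) (inj₂ (s , p)) (inj₂ (s , q)) (inj₂ (s , c))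
  gadget-midpoint {s} mid = record
    { distinct    = distinct ∘ inj₂-injective
    ; nonadjacent = nonadjacent
    ; adjacentˡ   = adjacentˡ
    ; adjacentʳ   = adjacentʳ
    ; unique      = λ where
        -- a clique vertex has a single neighbour in each copy
        (inj₁ t) e₁ e₂ → contradiction
          (cong (s ,_) (trans (sym (dec-true⁻¹ (_ ≟ᶜ _) e₁)) (dec-true⁻¹ (_ ≟ᶜ _) e₂))) distinct
        (inj₂ w) e₁ e₂ → cong inj₂ (unique w e₁ e₂)
    }
    where open UniqueMidpoint mid

  clique-midpoint : ∀ t →
    UniqueMidpoint (_~_ join) (inj₂ (0F , proj₁ (to t))) (inj₂ (1F , proj₂ (to t))) (inj₁ t)
  clique-midpoint t = record
    { distinct    = λ ()
    ; nonadjacent = refl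
    ; adjacentˡ   = dec-true (_ ≟ᶜ _) refl
    ; adjacentʳ   = dec-true (_ ≟ᶜ _) refl
    ; unique      = λ where
        (inj₁ t′) e₁ e₂ → cong inj₁ (injective
          (×-≡,≡→≡ (dec-true⁻¹ (_ ≟ᶜ _) e₁ , dec-true⁻¹ (_ ≟ᶜ _) e₂)))
        (inj₂ (0F , _)) _  ()
        (inj₂ (1F , _)) () _
    }

  join-midpoints : AllMidpoints (_~_ H) → AllMidpoints (_~_ join)
  join-midpoints _    (inj₁ t)       = _ , _ , clique-midpoint t
  join-midpoints mids (inj₂ (s , c)) =
    let (p , q , mid) = mids c in
    inj₂ (s , p) , inj₂ (s , q) , gadget-midpoint (copies-midpoint _≟_ H s mid)

clique⇒mC2≤edges : ∀ {m k} (G : Graph (m + k)) →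
  (∀ i j → i ≢ j → adj G (i ↑ˡ k) (j ↑ˡ k) ≡ true) → m C 2 ≤ edges G
clique⇒mC2≤edges {m} {k} G clique = begin
  m C 2                                           ≡⟨ ∑∑[i<j]≡nC2 m ⟨
  ∑[ i < m ] ∑[ j < m ] 𝟙 (toℕ i <ᵇ toℕ j)       ≤⟨ sum-mono-≤ (sum-mono-≤ ∘ clique-edge) ⟩
  ∑[ i < m ] ∑[ j < m ] edge G (i ↑ˡ k) (j ↑ˡ k)  ≤⟨ sum-mono-≤ (λ i → sum-↑ˡ≤sum {m} (edge G (i ↑ˡ k))) ⟩
  ∑[ i < m ] sum (edge G (i ↑ˡ k))                ≤⟨ sum-↑ˡ≤sum {m} {k} (sum ∘ edge G) ⟩
  ∑[ i < m + k ] sum (edge G i)                   ≡⟨ edges≡∑∑edge G ⟨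
  edges G                                         ∎
  where
  open ≤-Reasoning
  <ᵇ⇒≢ : ∀ {i j : Fin m} → T (toℕ i <ᵇ toℕ j) → i ≢ j
  <ᵇ⇒≢ {i} i<j refl = <-irrefl refl (<ᵇ⇒< (toℕ i) (toℕ i) i<j)
  clique-edge : ∀ i j → 𝟙 (toℕ i <ᵇ toℕ j) ≤ edge G (i ↑ˡ k) (j ↑ˡ k)
  clique-edge i j rewrite toℕ-↑ˡ i k | toℕ-↑ˡ j k with toℕ i <ᵇ toℕ j in i<j
  ... | false = z≤n
  ... | true rewrite clique i j (<ᵇ⇒≢ (subst T (sym i<j) tt)) = ≤-refl

module CycleCliqueGraph (R m : ℕ) (m≤s² : m ≤ (R * 5) * (R * 5)) where

  vertices : Fin (m + 2 * (R * 5)) ↔ (Fin m ⊎ (Fin 2 × (Fin R × Fin 5)))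
  vertices = (↔-refl ⊎-↔ (↔-refl ×-↔ *↔×) ↔-∘ *↔×) ↔-∘ +↔⊎

  labels : Fin m ↣ ((Fin R × Fin 5) × (Fin R × Fin 5))
  labels = ↔⇒↣ ((*↔× ×-↔ *↔×) ↔-∘ *↔×) ↣-∘ mk↣ (inject≤-injective m≤s² m≤s² _ _)

  open CliqueJoin (≡-dec _≟_ _≟_) (cycles R) labels using (join; join-midpoints)

  graph : Graph (m + 2 * (R * 5))
  graph = onFin vertices join

  graph-critical : DistanceCritical graph
  graph-critical = onFin-distanceCritical vertices join (join-midpoints (cycles-midpoints R))

  graph-clique : m C 2 ≤ edges graph
  graph-clique = clique⇒mC2≤edges graph λ i j i≢j →
    subst₂ (λ a b → _~_ join a b ≡ true) (sym (vertices-↑ˡ i)) (sym (vertices-↑ˡ j))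
           (cong not (dec-false (i ≟ j) i≢j))
    where
    vertices-↑ˡ : ∀ i → Inverse.to vertices (i ↑ˡ 2 * (R * 5)) ≡ inj₁ i
    vertices-↑ˡ i rewrite splitAt-↑ˡ m i (2 * (R * 5)) = refl

denseCriticalGraph : ∀ n r → 2 * (r * 5) ≤ n → n ≤ (r * 5) * (r * 5) →
  Σ (Graph n) λ G → DistanceCritical G × n C 2 ≤ edges G + 2 * (r * 5) * n
denseCriticalGraph n r j≤n n≤s² = subst P (m∸n+n≡m j≤n) (graph , graph-critical , bound)
  where
  j = 2 * (r * 5)
  m = n ∸ j
  P : ℕ → Set
  P N = Σ (Graph N) λ G → DistanceCritical G × N C 2 ≤ edges G + j * N
  open CycleCliqueGraph r m (≤-trans (m∸n≤m n j) n≤s²)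
  bound : (m + j) C 2 ≤ edges graph + j * (m + j)
  bound = ≤-trans ([m+j]C2≤mC2+j*[m+j] m j) (+-monoˡ-≤ (j * (m + j)) graph-clique)

floorSqrt : ∀ n → Σ ℕ λ r → r * r ≤ n × n < suc r * suc r
floorSqrt zero = 0 , z≤n , s≤s z≤n
floorSqrt (suc n) with floorSqrt n
... | r , r²≤n , n<[r+1]² with suc n <? suc r * suc r
...   | yes n+1<[r+1]² = r , m≤n⇒m≤1+n r²≤n , n+1<[r+1]²
...   | no  n+1≮[r+1]² = suc r , ≮⇒≥ n+1≮[r+1]² ,
                         ≤-<-trans n<[r+1]² (*-mono-< (n<1+n (suc r)) (n<1+n (suc r)))

cycleCount : ∀ n → 100 ≤ n → Σ ℕ λ r → r * r ≤ n × 2 * (r * 5) ≤ n × n ≤ (r * 5) * (r * 5)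
cycleCount n 100≤n = fromSqrt (floorSqrt n)
  where
  fromSqrt : (Σ ℕ λ r → r * r ≤ n × n < suc r * suc r) →
    Σ ℕ λ r → r * r ≤ n × 2 * (r * 5) ≤ n × n ≤ (r * 5) * (r * 5)
  fromSqrt (r , r²≤n , n<[r+1]²) = r , r²≤n , j≤n , n≤s²
    where
    open ≤-Reasoning
    10≤r : 10 ≤ r
    10≤r = ≮⇒≥ λ r<10 → <⇒≱ (<-≤-trans n<[r+1]² (*-mono-≤ r<10 r<10)) 100≤n
    j≤n : 2 * (r * 5) ≤ n
    j≤n = begin
      2 * (r * 5)  ≡⟨ solve (r ∷ []) ⟩
      10 * r       ≤⟨ *-monoˡ-≤ r 10≤r ⟩
      r * r        ≤⟨ r²≤n ⟩
      n            ∎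
    r+1≤5r : suc r ≤ r * 5
    r+1≤5r = begin
      suc r          ≤⟨ +-monoˡ-≤ r (≤-trans (s≤s z≤n) 10≤r) ⟩
      r + r          ≤⟨ m≤m+n (r + r) (r * 3) ⟩
      r + r + r * 3  ≡⟨ solve (r ∷ []) ⟩
      r * 5          ∎
    n≤s² : n ≤ (r * 5) * (r * 5)
    n≤s² = ≤-trans (<⇒≤ n<[r+1]²) (*-mono-≤ r+1≤5r r+1≤5r)

missing-edges-bound : ∀ {n c y r} → n * n ≤ 4 * c → r * r ≤ n → y ≤ 2 * (r * 5) * n →
  y ^ 2 * n ≤ 1600 * c ^ 2
missing-edges-bound {n} {c} {y} {r} n²≤4c r²≤n y≤jn = begin
  y ^ 2 * n                      ≤⟨ *-monoˡ-≤ n (^-monoˡ-≤ 2 y≤jn) ⟩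
  (2 * (r * 5) * n) ^ 2 * n      ≡⟨ expand ⟩
  100 * (r * r) * (n * (n * n))  ≤⟨ *-monoˡ-≤ (n * (n * n)) (*-monoʳ-≤ 100 r²≤n) ⟩
  100 * n * (n * (n * n))        ≡⟨ solve (n ∷ []) ⟩
  100 * ((n * n) * (n * n))      ≤⟨ *-monoʳ-≤ 100 (*-mono-≤ n²≤4c n²≤4c) ⟩
  100 * ((4 * c) * (4 * c))      ≡⟨ solve (c ∷ []) ⟩
  1600 * (c * (c * 1))           ∎
  where
  open ≤-Reasoning
  -- `x ^ 2` unfolded to `x * (x * 1)`: the ring solver rejects `_^_` on a compound base.
  expand : (2 * (r * 5) * n) * ((2 * (r * 5) * n) * 1) * n ≡ 100 * (r * r) * (n * (n * n))
  expand = solve (r ∷ n ∷ [])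

lowerBound : ∀ n → 100 ≤ n →
  Σ (Graph n) λ G → DistanceCritical G × ((n C 2) ∸ edges G) ^ 2 * n ≤ 1600 * (n C 2) ^ 2
lowerBound n 100≤n =
  let (r , r²≤n , j≤n , n≤s²) = cycleCount n 100≤n
      (G , critical , nC2≤) = denseCriticalGraph n r j≤n n≤s²
  in G , critical ,
     missing-edges-bound {c = n C 2} {r = r} (n*n≤4*nC2 n (≤-trans (s≤s (s≤s z≤n)) 100≤n)) r²≤n
       (m≤n+o⇒m∸n≤o (n C 2) (edges G) nC2≤)

theorem5p10 :
    (Σ ℕ λ c → Σ ℕ λ N → ∀ (n : ℕ) → 5 ≤ n → N ≤ n →
        Σ (Graph n) λ G → DistanceCritical G ×
          (((n C 2) ∸ edges G) ^ 2 * n ≤ c * (n C 2) ^ 2))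
    ×
    (Σ ℕ λ K → Σ ℕ λ N → ∀ (n : ℕ) → 5 ≤ n → N ≤ n →
        ∀ (G : Graph n) → DistanceCritical G →
          n C 2 ≤ K * n * ((n C 2) ∸ edges G))
theorem5p10 =
  (1600 , 100 , λ n _ 100≤n → lowerBound n 100≤n) ,
  (1 , 0 , λ n _ _ G critical → subst (λ k → n C 2 ≤ k * (n C 2 ∸ edges G))
                                      (sym (*-identityˡ n))
                                      (distanceCritical⇒nC2≤n*[nC2∸edges] G critical))
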